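{- Let $a\ge4$ be an even integer. The subtraction game $\mathcal{S}(1,a,3a)$ is periodic with period $3a+1$ and nim-sequence $\big((01)^{a/2}\,2\big)^2(01)^{a/2-1}\,2$. Moreover, the subtraction set has expansion $\{1,a,2a+1,3a\}^{*(3a+1)}$.
   Context: For a finite set $S$ of positive integers, the subtraction game $\mathcal{S}(S)$ is played on a single pile: two players alternately remove $s\in S$ coins (at most the pile size); the last mover wins. The nim-value is $\mathcal{G}(n)=\operatorname{mex}\{\mathcal{G}(n-s): s\in S, s\le n\}$. Words of single digits are written by juxtaposition, and $x^m$ denotes $m$-fold repetition of the block $x$. "The game is periodic with period $p$ and nim-sequence $W$" ($W$ a word of length $p$) means $\mathcal{G}(n+p)=\mathcal{G}(n)$ for all $n\ge0$, $p$ is the least such, and $\mathcal{G}(n)$ is the $((n\bmod p)+1)$-st letter of $W$ for all $n\ge0$. The expansion of $S$ is $S^{ex}=\{s\ge1:\mathcal{G}(n+s)\ne\mathcal{G}(n)\ \forall n\ge0\}$; "has expansion $T$" means $S^{ex}=T$. For a set $X$ and $p\ge1$, $X^{*p}=\{x+mp:x\in X,m\ge0\}$. -}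

module Defs where

open import Data.Nat using (ℕ; zero; suc; _+_; _*_; _∸_; _≤_; _<_; _≟_; _%_; NonZero)
open import Data.List using (List; []; _∷_; _++_; length)
open import Data.Maybe using (Maybe; just; nothing)
open import Data.Bool using (Bool; true; false; if_then_else_)
open import Data.Product using (_×_; Σ; ∃; _,_)
open import Data.Sum using (_⊎_)
open import Data.Empty using (⊥)
open import Relation.Nullary using (¬_; yes; no)
open import Relation.Binary.PropositionalEquality using (_≡_; _≢_)
open import Function.Bundles using (_⇔_)

elem : ℕ → List ℕ → Bool
elem k [] = false
elem k (x ∷ xs) with k ≟ x
... | yes _ = true
... | no  _ = elem k xs

-- mex of a finite list: least k not occurring (it is ≤ length of the list,
-- so searching with fuel = length l suffices)
mexAux : ℕ → ℕ → List ℕ → ℕ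
mexAux zero    k l = k
mexAux (suc f) k l = if elem k l then mexAux f (suc k) l else k

mex : List ℕ → ℕ
mex l = mexAux (length l) 0 l

at : List ℕ → ℕ → Maybe ℕ
at []       _       = nothing
at (x ∷ xs) zero    = just x
at (x ∷ xs) (suc i) = at xs i

-- options of the position with history h = [G(n-1), …, G(0)]:
-- for each s ∈ S with 1 ≤ s ≤ n, the value G(n-s) = h[s-1]
options : List ℕ → List ℕ → List ℕ
options []       h = []
options (s ∷ ss) h with at h (s ∸ 1) | s
... | just v  | suc _ = v ∷ options ss h
... | _       | _     = options ss h

hist : List ℕ → ℕ → List ℕ
hist S zero    = []
hist S (suc n) = mex (options S (hist S n)) ∷ hist S n

nimValue : List ℕ → ℕ → ℕ
nimValue S n = mex (options S (hist S n))

rep : ℕ → List ℕ → List ℕ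
rep zero    w = []
rep (suc m) w = w ++ rep m w

PeriodicWith : List ℕ → ℕ → List ℕ → Set
PeriodicWith S zero    W = ⊥
PeriodicWith S p@(suc _) W =
  (∀ n → nimValue S (n + p) ≡ nimValue S n)
  × (∀ q → 1 ≤ q → q < p → ¬ (∀ n → nimValue S (n + q) ≡ nimValue S n))
  × length W ≡ p
  × (∀ n → at W (n % p) ≡ just (nimValue S n))

InExpansion : List ℕ → ℕ → Set
InExpansion S s = 1 ≤ s × (∀ n → nimValue S (n + s) ≢ nimValue S n)

data _∈L_ (x : ℕ) : List ℕ → Set where
  here  : ∀ {xs} → x ∈L (x ∷ xs)
  there : ∀ {y xs} → x ∈L xs → x ∈L (y ∷ xs)

InStar : List ℕ → ℕ → ℕ → Set
InStar X p s = ∃ λ x → ∃ λ m → x ∈L X × s ≡ x + m * p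

HasExpansion : List ℕ → (ℕ → Set) → Set
HasExpansion S T = ∀ s → (InExpansion S s ⇔ T s)

module Submission where

-- Let a = 2k with k ≥ 2, write k = j + 2, and let p = 3a + 1 = 6j + 13.  The proof runs as follows.
--
-- The nim-sequence is the unique
--   function g with g(n) = mex {g(n - s) : s ∈ S, s ≤ n}, so to identify it it suffices to
--   exhibit one solution of this recurrence.  Since the mex of a list is never one of its
--   entries, every move s ∈ S lies in the expansion; the expansion is moreover invariant under
--   adding a period and under s ↦ p - s for a period p.
-- * The candidate ν reads the word W = (01)^k 2 (01)^k 2 (01)^(k-1) 2 of length p cyclically.
--   Every residue r < p lies in one of the three blocks of W (data type Residue); for each
--   kind of residue the positions n - 1, n - a, n - 3a of n = r + q·p are located in their
--   residue classes, and the mex of their values is the value of r.  Hence ν is the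
--   nim-sequence; it has period p by construction.
-- * For every residue 0 < r < p an explicit position shows that r is no period, and every
--   residue outside {1, a, 2a + 1, 3a} has an explicit position n with ν(n + r) = ν(n), so it
--   is not in the expansion.  Together with the general facts this gives the expansion.

open import Defs
open import Data.Nat using (ℕ; zero; suc; _+_; _*_; _∸_; _≤_; _<_; s≤s; z≤n; z<s; _≤?_; _<?_; _≟_; _%_; _/_)
open import Data.Nat.Properties
open import Data.Nat.DivMod using (m%n<n; m≡m%n+[m/n]*n; [m+n]%n≡m%n; [m+kn]%n≡m%n; m<n⇒m%n≡m; m*n/n≡m)
open import Data.Nat.Divisibility using (_∣_; divides)
open import Data.Nat.Tactic.RingSolver using (solve)
open import Data.Bool using (true; false)
open import Data.List using (List; []; _∷_; _++_; length)
open import Data.List.Properties using (++-assoc)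
open import Data.Maybe using (just; nothing; fromMaybe)
open import Data.Product using (Σ; ∃; _×_; _,_)
open import Data.Sum using (_⊎_; inj₁; inj₂)
open import Data.Empty using (⊥-elim)
open import Function.Bundles using (mk⇔)
open import Relation.Nullary using (¬_; yes; no; contradiction)
open import Relation.Binary.PropositionalEquality

countFrom : ℕ → List ℕ → ℕ
countFrom k [] = 0
countFrom k (x ∷ xs) with k ≤? x
... | yes _ = suc (countFrom k xs)
... | no  _ = countFrom k xs

countFrom-≤-length : ∀ k l → countFrom k l ≤ length l
countFrom-≤-length k [] = z≤n
countFrom-≤-length k (x ∷ xs) with k ≤? x
... | yes _ = s≤s (countFrom-≤-length k xs)
... | no  _ = m≤n⇒m≤1+n (countFrom-≤-length k xs)

countFrom-mono : ∀ k l → countFrom (suc k) l ≤ countFrom k l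
countFrom-mono k [] = z≤n
countFrom-mono k (x ∷ xs) with suc k ≤? x | k ≤? x
... | yes _   | yes _  = s≤s (countFrom-mono k xs)
... | yes k<x | no k≰x = contradiction (<⇒≤ k<x) k≰x
... | no  _   | yes _  = m≤n⇒m≤1+n (countFrom-mono k xs)
... | no  _   | no  _  = countFrom-mono k xs

countFrom-drop : ∀ {k l} → k ∈L l → countFrom (suc k) l < countFrom k l
countFrom-drop {k} {_ ∷ xs} here with suc k ≤? k | k ≤? k
... | yes k<k | _      = contradiction k<k (n≮n k)
... | no  _   | yes _  = s≤s (countFrom-mono k xs)
... | no  _   | no k≰k = contradiction ≤-refl k≰k
countFrom-drop {k} {x ∷ xs} (there k∈xs) with suc k ≤? x | k ≤? x
... | yes _   | yes _  = s≤s (countFrom-drop k∈xs)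
... | yes k<x | no k≰x = contradiction (<⇒≤ k<x) k≰x
... | no  _   | yes _  = m<n⇒m<1+n (countFrom-drop k∈xs)
... | no  _   | no  _  = countFrom-drop k∈xs

elem-complete : ∀ {x l} → x ∈L l → elem x l ≡ true
elem-complete {x} here with x ≟ x
... | yes _  = refl
... | no x≢x = contradiction refl x≢x
elem-complete {x} {y ∷ _} (there x∈l) with x ≟ y
... | yes _ = refl
... | no  _ = elem-complete x∈l

elem-sound : ∀ x l → elem x l ≡ true → x ∈L l
elem-sound x (y ∷ ys) e with x ≟ y
... | yes refl = here
... | no  _    = there (elem-sound x ys e)

-- The search mexAux f k l cannot return a member of l as long as its fuel f
-- covers every entry of l that is ≥ k: each failed candidate uses up one entry.
mexAux-fresh : ∀ f k l → countFrom k l ≤ f → ¬ (mexAux f k l ∈L l)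
mexAux-fresh zero k l c≤0 k∈l = n≮0 (≤-trans (countFrom-drop k∈l) c≤0)
mexAux-fresh (suc f) k l c≤f with elem k l in e
... | true  = mexAux-fresh f (suc k) l
                (≤-pred (≤-trans (countFrom-drop (elem-sound k l e)) c≤f))
... | false = λ k∈l → contradiction (trans (sym (elem-complete k∈l)) e) λ ()

mex-fresh : ∀ {x l} → x ∈L l → mex l ≢ x
mex-fresh {l = l} x∈l refl = mexAux-fresh (length l) 0 l (countFrom-≤-length 0 l) x∈l

values : (ℕ → ℕ) → ℕ → List ℕ
values g zero    = []
values g (suc n) = g n ∷ values g n

SolvesMex : List ℕ → (ℕ → ℕ) → Set
SolvesMex S g = ∀ n → g n ≡ mex (options S (values g n))

values-at : ∀ g {n t m} → n ≡ suc t + m → at (values g n) t ≡ just (g m)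
values-at g {t = zero}  refl = refl
values-at g {t = suc t} refl = values-at g {t = t} refl

values-beyond : ∀ g {n t} → n ≤ t → at (values g n) t ≡ nothing
values-beyond g {zero}  _         = refl
values-beyond g {suc n} (s≤s n≤t) = values-beyond g n≤t

option-present : ∀ g ss {n t m} → n ≡ suc t + m →
  options (suc t ∷ ss) (values g n) ≡ g m ∷ options ss (values g n)
option-present g ss {n} {t} e rewrite values-at g {n} {t} e = refl

option-absent : ∀ g ss {n t} → n < suc t →
  options (suc t ∷ ss) (values g n) ≡ options ss (values g n)
option-absent g ss {n} {t} n<s rewrite values-beyond g {n} {t} (≤-pred n<s) = refl

hist-values : ∀ S g → SolvesMex S g → ∀ n → hist S n ≡ values g n
hist-values S g solves zero    = refl
hist-values S g solves (suc n) = cong₂ _∷_ head (hist-values S g solves n)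
  where
  head : mex (options S (hist S n)) ≡ g n
  head = trans (cong (λ h → mex (options S h)) (hist-values S g solves n)) (sym (solves n))

nimValue-unique : ∀ S g → SolvesMex S g → ∀ n → nimValue S n ≡ g n
nimValue-unique S g solves n =
  trans (cong (λ h → mex (options S h)) (hist-values S g solves n)) (sym (solves n))

nimValue-solves : ∀ S → SolvesMex S (nimValue S)
nimValue-solves S n = cong (λ h → mex (options S h)) (hist-is-values n)
  where
  hist-is-values : ∀ n → hist S n ≡ values (nimValue S) n
  hist-is-values zero    = refl
  hist-is-values (suc n) = cong (nimValue S n ∷_) (hist-is-values n)

options-tail : ∀ s ss h {v} → v ∈L options ss h → v ∈L options (s ∷ ss) h
options-tail zero    ss h v∈ with at h 0
... | just _  = v∈
... | nothing = v∈
options-tail (suc t) ss h v∈ with at h t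
... | just _  = there v∈
... | nothing = v∈

option-member : ∀ {S t h v} → suc t ∈L S → at h t ≡ just v → v ∈L options S h
option-member here e rewrite e = here
option-member {s ∷ ss} {h = h} (there t∈ss) e = options-tail s ss h (option-member t∈ss e)

-- Every move of S lies in the expansion: G(n + s) is a mex over a set containing G(n).
moves-in-expansion : ∀ S {s} → s ∈L S → 1 ≤ s → InExpansion S s
moves-in-expansion S {suc t} s∈S 1≤s = 1≤s , differ
  where
  differ : ∀ n → nimValue S (n + suc t) ≢ nimValue S n
  differ n rewrite nimValue-solves S (n + suc t) =
    mex-fresh (option-member s∈S (values-at (nimValue S) (+-comm n (suc t))))

Periodic : List ℕ → ℕ → Set
Periodic S p = ∀ n → nimValue S (n + p) ≡ nimValue S n

periodic-multiple : ∀ {S p} → Periodic S p → ∀ m n → nimValue S (n + m * p) ≡ nimValue S n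
periodic-multiple {S}     per zero    n = cong (nimValue S) (+-identityʳ n)
periodic-multiple {S} {p} per (suc m) n = begin
  nimValue S (n + (p + m * p)) ≡⟨ cong (nimValue S) (sym (+-assoc n p (m * p))) ⟩
  nimValue S (n + p + m * p)   ≡⟨ periodic-multiple {S} per m (n + p) ⟩
  nimValue S (n + p)           ≡⟨ per n ⟩
  nimValue S n                 ∎
  where open ≡-Reasoning

expansion-+-period : ∀ {S p x} → Periodic S p → InExpansion S x → ∀ m → InExpansion S (x + m * p)
expansion-+-period {S} {p} {x} per (1≤x , differ) m = ≤-trans 1≤x (m≤m+n x (m * p)) , differ′
  where
  differ′ : ∀ n → nimValue S (n + (x + m * p)) ≢ nimValue S n
  differ′ n eq = differ n (begin
    nimValue S (n + x)             ≡⟨ sym (periodic-multiple {S} per m (n + x)) ⟩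
    nimValue S (n + x + m * p)     ≡⟨ cong (nimValue S) (+-assoc n x (m * p)) ⟩
    nimValue S (n + (x + m * p))   ≡⟨ eq ⟩
    nimValue S n                   ∎)
    where open ≡-Reasoning

expansion-complement : ∀ {S p x y} → Periodic S p → x + y ≡ p → 1 ≤ y →
  InExpansion S x → InExpansion S y
expansion-complement {S} {p} {x} {y} per x+y≡p 1≤y (_ , differ) = 1≤y , differ′
  where
  differ′ : ∀ n → nimValue S (n + y) ≢ nimValue S n
  differ′ n eq = differ (n + y) (begin
    nimValue S (n + y + x)   ≡⟨ cong (nimValue S) (trans (+-assoc n y x) (cong (n +_) y+x≡p)) ⟩
    nimValue S (n + p)       ≡⟨ per n ⟩
    nimValue S n             ≡⟨ sym eq ⟩
    nimValue S (n + y)       ∎)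
    where
    open ≡-Reasoning
    y+x≡p : y + x ≡ p
    y+x≡p = trans (+-comm y x) x+y≡p

star-+-period : ∀ {X p r} → InStar X p r → ∀ q → InStar X p (r + q * p)
star-+-period {p = p} (x , m , x∈X , refl) q =
  x , m + q , x∈X , trans (+-assoc x (m * p) (q * p)) (cong (x +_) (sym (*-distribʳ-+ p m q)))

data Block (m : ℕ) : ℕ → Set where
  even : ∀ i → i < m → Block m (i + i)
  odd  : ∀ i → i < m → Block m (suc (i + i))
  two  : Block m (m + m)

blockValue : ∀ {m x} → Block m x → ℕ
blockValue (even _ _) = 0
blockValue (odd _ _)  = 1
blockValue two        = 2

block : ℕ → List ℕ → List ℕ
block m t = rep m (0 ∷ 1 ∷ []) ++ 2 ∷ t

rep-even : ∀ {m i} u → i < m → at (rep m (0 ∷ 1 ∷ []) ++ u) (i + i) ≡ just 0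
rep-even {suc m} {zero}  u _         = refl
rep-even {suc m} {suc i} u (s≤s i<m) =
  trans (cong (λ x → at (rep (suc m) (0 ∷ 1 ∷ []) ++ u) (suc x)) (+-suc i i)) (rep-even u i<m)

rep-odd : ∀ {m i} u → i < m → at (rep m (0 ∷ 1 ∷ []) ++ u) (suc (i + i)) ≡ just 1
rep-odd {suc m} {zero}  u _         = refl
rep-odd {suc m} {suc i} u (s≤s i<m) =
  trans (cong (λ x → at (rep (suc m) (0 ∷ 1 ∷ []) ++ u) (suc (suc x))) (+-suc i i)) (rep-odd u i<m)

rep-skip : ∀ m u x → at (rep m (0 ∷ 1 ∷ []) ++ u) (m + m + x) ≡ at u x
rep-skip zero    u x = refl
rep-skip (suc m) u x =
  trans (cong (λ y → at (rep (suc m) (0 ∷ 1 ∷ []) ++ u) (suc (y + x))) (+-suc m m)) (rep-skip m u x)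

block-at : ∀ {m x} (b : Block m x) t → at (block m t) x ≡ just (blockValue b)
block-at     (even i i<m) t = rep-even (2 ∷ t) i<m
block-at     (odd i i<m)  t = rep-odd (2 ∷ t) i<m
block-at {m} two          t = trans (cong (at (block m t)) (sym (+-identityʳ (m + m)))) (rep-skip m (2 ∷ t) 0)

block-skip : ∀ m t y → at (block m t) (m + m + suc y) ≡ at t y
block-skip m t y = rep-skip m (2 ∷ t) (suc y)

block-length : ∀ m t → length (block m t) ≡ m + m + suc (length t)
block-length zero    t = refl
block-length (suc m) t = cong suc (trans (cong suc (block-length m t)) (cong (_+ suc (length t)) (sym (+-suc m m))))

halve : ∀ x → ∃ λ i → x ≡ i + i ⊎ x ≡ suc (i + i)
halve zero = 0 , inj₁ refl
halve (suc x) with halve x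
... | i , inj₁ refl = i , inj₂ refl
... | i , inj₂ refl = suc i , inj₁ (cong suc (sym (+-suc i i)))

halve-≤ : ∀ {i m} → i + i ≤ m + m → i ≤ m
halve-≤ {i} {m} h with i ≤? m
... | yes i≤m = i≤m
... | no  i≰m = contradiction h (<⇒≱ (+-mono-< (≰⇒> i≰m) (≰⇒> i≰m)))

halve-< : ∀ {i m} → suc (i + i) ≤ m + m → i < m
halve-< {i} {m} h with i <? m
... | yes i<m = i<m
... | no  i≮m = contradiction (≤-trans h (+-mono-≤ (≮⇒≥ i≮m) (≮⇒≥ i≮m))) (n≮n (i + i))

block-position : ∀ m x → x ≤ m + m → Block m x
block-position m x x≤ with halve x
... | i , inj₂ refl = odd i (halve-< x≤)
... | i , inj₁ refl with m≤n⇒m<n∨m≡n (halve-≤ x≤)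
...   | inj₁ i<m  = even i i<m
...   | inj₂ refl = two

even-< : ∀ {i m} → i < m → i + i < m + m
even-< i<m = +-mono-< i<m i<m

odd-< : ∀ {i m} → i < m → suc (i + i) < m + m
odd-< {i} {m} i<m = subst (_≤ m + m) (cong suc (+-suc i i)) (+-mono-≤ i<m i<m)

block-≤ : ∀ {m x} → Block m x → x ≤ m + m
block-≤ (even i i<m) = <⇒≤ (even-< i<m)
block-≤ (odd i i<m)  = <⇒≤ (odd-< i<m)
block-≤ two          = ≤-refl

<-by-gap : ∀ {x y} d → suc (x + d) ≡ y → x < y
<-by-gap {x} d refl = s≤s (m≤m+n x d)

≤-or-beyond : ∀ b x → x ≤ b ⊎ ∃ λ y → x ≡ b + suc y
≤-or-beyond b       zero    = inj₁ z≤n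
≤-or-beyond zero    (suc x) = inj₂ (x , refl)
≤-or-beyond (suc b) (suc x) with ≤-or-beyond b x
... | inj₁ x≤b      = inj₁ (s≤s x≤b)
... | inj₂ (y , eq) = inj₂ (y , cong suc eq)

NimSequenceAndExpansion : ℕ → Set
NimSequenceAndExpansion a =
  PeriodicWith (1 ∷ a ∷ 3 * a ∷ []) (1 + 3 * a)
    (rep 2 (rep (a / 2) (0 ∷ 1 ∷ []) ++ (2 ∷ [])) ++ rep (a / 2 ∸ 1) (0 ∷ 1 ∷ []) ++ (2 ∷ []))
  × HasExpansion (1 ∷ a ∷ 3 * a ∷ []) (InStar (1 ∷ a ∷ 2 * a + 1 ∷ 3 * a ∷ []) (1 + 3 * a))

-- If 3a + 1 is a period of S(1, a, 3a), then {1, a, 2a + 1, 3a}^{*(3a+1)} lies in the expansion: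
-- 1, a, 3a are moves, and 2a + 1 is the complement of a with respect to the period.
star-in-expansion : ∀ a → 1 ≤ a → Periodic (1 ∷ a ∷ 3 * a ∷ []) (1 + 3 * a) →
  ∀ s → InStar (1 ∷ a ∷ 2 * a + 1 ∷ 3 * a ∷ []) (1 + 3 * a) s → InExpansion (1 ∷ a ∷ 3 * a ∷ []) s
star-in-expansion a 1≤a per s (x , m , x∈X , refl) = expansion-+-period {S} per (generator x∈X) m
  where
  S : List ℕ
  S = 1 ∷ a ∷ 3 * a ∷ []

  generator : ∀ {x} → x ∈L (1 ∷ a ∷ 2 * a + 1 ∷ 3 * a ∷ []) → InExpansion S x
  generator here                          = moves-in-expansion S here ≤-refl
  generator (there here)                  = moves-in-expansion S (there here) 1≤a
  generator (there (there here))          =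
    expansion-complement {S} {x = a} {y = 2 * a + 1} per (solve (a ∷ [])) (m≤n+m 1 (2 * a))
      (generator (there here))
  generator (there (there (there here)))  = moves-in-expansion S (there (there here)) (≤-trans 1≤a (m≤m+n a _))
  generator (there (there (there (there ()))))

-- The game S(1, a, 3a) for a = 2k, k = j + 2.  The solver-facing arithmetic writes a and the
-- period p = 3a + 1 as the polynomials 4 + 2j and 13 + 6j, since the ring solver does not unfold
-- definitions.
module Game (j : ℕ) where

  S : List ℕ
  S = 1 ∷ (2 + j) * 2 ∷ 3 * ((2 + j) * 2) ∷ []

  word : List ℕ
  word = block (2 + j) (block (2 + j) (block (1 + j) []))

  word-length : length word ≡ 13 + 6 * j
  word-length
    rewrite block-length (2 + j) (block (2 + j) (block (1 + j) []))
          | block-length (2 + j) (block (1 + j) [])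
          | block-length (1 + j) [] = solve (j ∷ [])

  word-shape :
    rep 2 (rep (2 + j) (0 ∷ 1 ∷ []) ++ (2 ∷ [])) ++ rep (1 + j) (0 ∷ 1 ∷ []) ++ (2 ∷ []) ≡ word
  word-shape = begin
    (A ++ (A ++ [])) ++ E ≡⟨ ++-assoc A (A ++ []) E ⟩
    A ++ ((A ++ []) ++ E) ≡⟨ cong (A ++_) (++-assoc A [] E) ⟩
    A ++ (A ++ E)         ≡⟨ ++-assoc (rep (2 + j) (0 ∷ 1 ∷ [])) (2 ∷ []) (A ++ E) ⟩
    block (2 + j) (A ++ E) ≡⟨ cong (block (2 + j)) (++-assoc (rep (2 + j) (0 ∷ 1 ∷ [])) (2 ∷ []) E) ⟩
    word                  ∎
    where
    open ≡-Reasoning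
    A E : List ℕ
    A = rep (2 + j) (0 ∷ 1 ∷ []) ++ (2 ∷ [])
    E = rep (1 + j) (0 ∷ 1 ∷ []) ++ (2 ∷ [])

  -- Residues r < p, by the block of W they fall in: the first block occupies 0 … 2k, the second
  -- one 2k + 1 … 4k + 1 and the third one 4k + 2 … 6k; in terms of j these start at 0, 5 + 2j, 10 + 4j.
  data Residue : ℕ → Set where
    first  : ∀ {x} → Block (2 + j) x → Residue x
    second : ∀ {x} → Block (2 + j) x → Residue (5 + 2 * j + x)
    third  : ∀ {x} → Block (1 + j) x → Residue (10 + 4 * j + x)

  value : ∀ {r} → Residue r → ℕ
  value (first b)  = blockValue b
  value (second b) = blockValue b
  value (third b)  = blockValue b

  second-offset : ∀ x → 5 + 2 * j + x ≡ (2 + j) + (2 + j) + suc x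
  second-offset x = solve (j ∷ x ∷ [])

  third-offset : ∀ x → 10 + 4 * j + x ≡ (2 + j) + (2 + j) + suc ((2 + j) + (2 + j) + suc x)
  third-offset x = solve (j ∷ x ∷ [])

  word-at : ∀ {r} (c : Residue r) → at word r ≡ just (value c)
  word-at (first b) = block-at b _
  word-at (second {x} b) = begin
    at word (5 + 2 * j + x)             ≡⟨ cong (at word) (second-offset x) ⟩
    at word ((2 + j) + (2 + j) + suc x) ≡⟨ block-skip (2 + j) _ x ⟩
    at (block (2 + j) _) x              ≡⟨ block-at b _ ⟩
    just (blockValue b)                 ∎
    where open ≡-Reasoning
  word-at (third {x} b) = begin
    at word (10 + 4 * j + x)                                       ≡⟨ cong (at word) (third-offset x) ⟩
    at word ((2 + j) + (2 + j) + suc ((2 + j) + (2 + j) + suc x)) ≡⟨ block-skip (2 + j) _ _ ⟩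
    at (block (2 + j) _) ((2 + j) + (2 + j) + suc x)               ≡⟨ block-skip (2 + j) _ x ⟩
    at (block (1 + j) []) x                                        ≡⟨ block-at b [] ⟩
    just (blockValue b)                                            ∎
    where open ≡-Reasoning

  residue-< : ∀ {r} → Residue r → r < 13 + 6 * j
  residue-< (first b) = ≤-<-trans (block-≤ b) (<-by-gap (8 + 4 * j) gap)
    where gap : suc ((2 + j) + (2 + j) + (8 + 4 * j)) ≡ 13 + 6 * j
          gap = solve (j ∷ [])
  residue-< (second b) = ≤-<-trans (+-monoʳ-≤ (5 + 2 * j) (block-≤ b)) (<-by-gap (3 + 2 * j) gap)
    where gap : suc (5 + 2 * j + ((2 + j) + (2 + j)) + (3 + 2 * j)) ≡ 13 + 6 * j
          gap = solve (j ∷ [])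
  residue-< (third b) = ≤-<-trans (+-monoʳ-≤ (10 + 4 * j) (block-≤ b)) (<-by-gap 0 gap)
    where gap : suc (10 + 4 * j + ((1 + j) + (1 + j)) + 0) ≡ 13 + 6 * j
          gap = solve (j ∷ [])

  classify : ∀ r → r < 13 + 6 * j → Residue r
  classify r r<p with ≤-or-beyond ((2 + j) + (2 + j)) r
  ... | inj₁ r≤ = first (block-position _ r r≤)
  ... | inj₂ (x , refl) with ≤-or-beyond ((2 + j) + (2 + j)) x
  ...   | inj₁ x≤ = subst Residue (second-offset x) (second (block-position _ x x≤))
  ...   | inj₂ (y , refl) with ≤-or-beyond ((1 + j) + (1 + j)) y
  ...     | inj₁ y≤ = subst Residue (third-offset y) (third (block-position _ y y≤))
  ...     | inj₂ (z , refl) = contradiction (subst (_< 13 + 6 * j) (too-big z) r<p) (m+n≮m (13 + 6 * j) z)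
    where
    too-big : ∀ z →
      (2 + j) + (2 + j) + suc ((2 + j) + (2 + j) + suc ((1 + j) + (1 + j) + suc z)) ≡ 13 + 6 * j + z
    too-big z = solve (j ∷ z ∷ [])

  p : ℕ
  p = 1 + 3 * ((2 + j) * 2)

  p≡ : 1 + 3 * ((2 + j) * 2) ≡ 13 + 6 * j
  p≡ = solve (j ∷ [])

  +-multiple-mod : ∀ m q → (m + q * (13 + 6 * j)) % p ≡ m % p
  +-multiple-mod m q = trans (cong (λ p′ → (m + q * p′) % p) (sym p≡)) ([m+kn]%n≡m%n m q p)

  residue-mod : ∀ {r} (c : Residue r) q → (r + q * (13 + 6 * j)) % p ≡ r
  residue-mod {r} c q = trans (+-multiple-mod r q) (m<n⇒m%n≡m (subst (r <_) (sym p≡) (residue-< c)))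

  -- The candidate nim-sequence: the word read cyclically (its length is p, so the default 0 is never used).
  ν : ℕ → ℕ
  ν n = fromMaybe 0 (at word (n % p))

  ν-at : ∀ {n r} (c : Residue r) q → n ≡ r + q * (13 + 6 * j) → ν n ≡ value c
  ν-at {r = r} c q refl = begin
    fromMaybe 0 (at word ((r + q * (13 + 6 * j)) % p)) ≡⟨ cong (λ i → fromMaybe 0 (at word i)) (residue-mod c q) ⟩
    fromMaybe 0 (at word r)                             ≡⟨ cong (fromMaybe 0) (word-at c) ⟩
    value c                                             ∎
    where open ≡-Reasoning

  ν-+-multiple : ∀ m q → ν (m + q * (13 + 6 * j)) ≡ ν m
  ν-+-multiple m q = cong (λ i → fromMaybe 0 (at word i)) (+-multiple-mod m q)

  residue-of : ∀ n → Σ ℕ λ r → Σ ℕ λ q → Residue r × n ≡ r + q * (13 + 6 * j)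
  residue-of n = n % p , n / p , classify _ (subst (n % p <_) p≡ (m%n<n n p)) ,
    trans (m≡m%n+[m/n]*n n p) (cong (λ p′ → n % p + n / p * p′) p≡)

  ν-lookup : ∀ n → at word (n % p) ≡ just (ν n)
  ν-lookup n with residue-of n
  ... | r , q , c , refl =
    trans (cong (at word) (residue-mod c q)) (trans (word-at c) (cong just (sym (ν-at c q refl))))

  three-options : ∀ g {n m₁ m₂ m₃} →
    n ≡ 1 + m₁ → n ≡ (2 + j) * 2 + m₂ → n ≡ 3 * ((2 + j) * 2) + m₃ →
    options S (values g n) ≡ g m₁ ∷ g m₂ ∷ g m₃ ∷ []
  three-options g e₁ e₂ e₃ =
    trans (option-present g _ e₁) (cong (g _ ∷_)
      (trans (option-present g _ e₂) (cong (g _ ∷_) (option-present g [] e₃))))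

  -- In the first period the moves a and 3a may exceed the position.
  two-options : ∀ g {n m₁ m₂} → n ≡ 1 + m₁ → n ≡ (2 + j) * 2 + m₂ → n < 3 * ((2 + j) * 2) →
    options S (values g n) ≡ g m₁ ∷ g m₂ ∷ []
  two-options g e₁ e₂ n<3a =
    trans (option-present g _ e₁) (cong (g _ ∷_)
      (trans (option-present g _ e₂) (cong (g _ ∷_) (option-absent g [] n<3a))))

  a-double : (2 + j) + (2 + j) ≡ (2 + j) * 2
  a-double = solve (j ∷ [])

  one-option : ∀ g {n m₁} → n ≡ 1 + m₁ → n < (2 + j) + (2 + j) → options S (values g n) ≡ g m₁ ∷ []
  one-option g {n} e₁ n<a =
    trans (option-present g _ e₁) (cong (g _ ∷_)
      (trans (option-absent g _ n<a′) (option-absent g [] (≤-trans n<a′ (m≤m+n _ _)))))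
    where
    n<a′ : n < (2 + j) * 2
    n<a′ = subst (n <_) a-double n<a

  Recurrence : ∀ {r} → Residue r → ℕ → Set
  Recurrence {r} c q = value c ≡ mex (options S (values ν (r + q * (13 + 6 * j))))

  from-three : ∀ {r} (c : Residue r) q {r₁ r₂ r₃}
    (c₁ : Residue r₁) q₁ (c₂ : Residue r₂) q₂ (c₃ : Residue r₃) q₃ →
    r + q * (13 + 6 * j) ≡ 1 + (r₁ + q₁ * (13 + 6 * j)) →
    r + q * (13 + 6 * j) ≡ (2 + j) * 2 + (r₂ + q₂ * (13 + 6 * j)) →
    r + q * (13 + 6 * j) ≡ 3 * ((2 + j) * 2) + (r₃ + q₃ * (13 + 6 * j)) →
    value c ≡ mex (value c₁ ∷ value c₂ ∷ value c₃ ∷ []) → Recurrence c q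
  from-three c q c₁ q₁ c₂ q₂ c₃ q₃ e₁ e₂ e₃ mex-ok =
    trans mex-ok (sym (cong mex (trans (three-options ν e₁ e₂ e₃)
      (cong₂ _∷_ (ν-at c₁ q₁ refl) (cong₂ _∷_ (ν-at c₂ q₂ refl) (cong (_∷ []) (ν-at c₃ q₃ refl)))))))

  from-two : ∀ {r} (c : Residue r) {r₁ r₂} (c₁ : Residue r₁) (c₂ : Residue r₂) →
    r ≡ 1 + r₁ → r ≡ (2 + j) * 2 + r₂ → r < 3 * ((2 + j) * 2) →
    value c ≡ mex (value c₁ ∷ value c₂ ∷ []) → Recurrence c 0
  from-two {r} c c₁ c₂ e₁ e₂ r<3a mex-ok rewrite +-identityʳ r =
    trans mex-ok (sym (cong mex (trans (two-options ν e₁ e₂ r<3a)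
      (cong₂ _∷_ (ν-at c₁ 0 (sym (+-identityʳ _))) (cong (_∷ []) (ν-at c₂ 0 (sym (+-identityʳ _))))))))

  from-one : ∀ {r} (c : Residue r) {r₁} (c₁ : Residue r₁) →
    r ≡ 1 + r₁ → r < (2 + j) + (2 + j) → value c ≡ mex (value c₁ ∷ []) → Recurrence c 0
  from-one {r} c c₁ e₁ r<a mex-ok rewrite +-identityʳ r =
    trans mex-ok (sym (cong mex (trans (one-option ν e₁ r<a)
      (cong (_∷ []) (ν-at c₁ 0 (sym (+-identityʳ _)))))))

  first-early : (2 + j) + (2 + j) < 3 * ((2 + j) * 2)
  first-early = <-by-gap (7 + 4 * j) gap
    where gap : suc ((2 + j) + (2 + j) + (7 + 4 * j)) ≡ 3 * ((2 + j) * 2)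
          gap = solve (j ∷ [])

  second-early : ∀ {x} → Block (2 + j) x → 5 + 2 * j + x < 3 * ((2 + j) * 2)
  second-early b = ≤-<-trans (+-monoʳ-≤ (5 + 2 * j) (block-≤ b)) (<-by-gap (2 + 2 * j) gap)
    where gap : suc (5 + 2 * j + ((2 + j) + (2 + j)) + (2 + 2 * j)) ≡ 3 * ((2 + j) * 2)
          gap = solve (j ∷ [])

  third-early : ∀ {x} → x < (1 + j) + (1 + j) → 10 + 4 * j + x < 3 * ((2 + j) * 2)
  third-early {x} x< = subst (10 + 4 * j + x <_) gap (+-monoʳ-< (10 + 4 * j) x<)
    where gap : 10 + 4 * j + ((1 + j) + (1 + j)) ≡ 3 * ((2 + j) * 2)
          gap = solve (j ∷ [])

  shorter : ∀ {i m} → suc i < m → i < m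
  shorter = <-trans (n<1+n _)

  -- The recurrence, residue by residue.  In each case the options n - 1, n - a, n - 3a of
  -- n = r + q·p are placed in their classes: n - 3a ≡ n + 1 and n - a ≡ n + 2a + 1 (mod p).
  recurrence-first : ∀ {x} (b : Block (2 + j) x) q → Recurrence (first b) q
  recurrence-first (even zero _) zero = refl
  recurrence-first b@(even zero _) (suc q) =
    from-three (first b) (suc q) (third two) q (second two) q (first (odd 0 z<s)) q
      (solve (j ∷ q ∷ [])) (solve (j ∷ q ∷ [])) (solve (j ∷ q ∷ [])) refl
  recurrence-first b@(even (suc i) h) zero =
    from-one (first b) (first (odd i (shorter h))) (solve (i ∷ [])) (even-< h) refl
  recurrence-first b@(even (suc i) h) (suc q) =
    from-three (first b) (suc q) (first (odd i (shorter h))) (suc q) (third (odd i (≤-pred h))) q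
      (first (odd (suc i) h)) q
      (solve (j ∷ i ∷ q ∷ [])) (solve (j ∷ i ∷ q ∷ [])) (solve (j ∷ i ∷ q ∷ [])) refl
  recurrence-first b@(odd i h) zero = from-one (first b) (first (even i h)) refl (odd-< h) refl
  recurrence-first b@(odd i h) (suc q) with m<1+n⇒m<n∨m≡n h
  ... | inj₁ i<1+j =
    from-three (first b) (suc q) (first (even i h)) (suc q) (third (even i i<1+j)) q
      (first (even (suc i) (s≤s i<1+j))) q
      (solve (j ∷ i ∷ q ∷ [])) (solve (j ∷ i ∷ q ∷ [])) (solve (j ∷ i ∷ q ∷ [])) refl
  ... | inj₂ refl =
    from-three (first b) (suc q) (first (even (1 + j) h)) (suc q) (third two) q (first two) q
      (solve (j ∷ q ∷ [])) (solve (j ∷ q ∷ [])) (solve (j ∷ q ∷ [])) refl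
  recurrence-first two zero =
    from-two (first two) (first (odd (1 + j) ≤-refl)) (first (even 0 z<s))
      (solve (j ∷ [])) (solve (j ∷ [])) first-early refl
  recurrence-first two (suc q) =
    from-three (first two) (suc q) (first (odd (1 + j) ≤-refl)) (suc q) (first (even 0 z<s)) (suc q)
      (second (even 0 z<s)) q
      (solve (j ∷ q ∷ [])) (solve (j ∷ q ∷ [])) (solve (j ∷ q ∷ [])) refl

  recurrence-second : ∀ {x} (b : Block (2 + j) x) q → Recurrence (second b) q
  recurrence-second b@(even zero _) zero =
    from-two (second b) (first two) (first (odd 0 z<s)) (solve (j ∷ [])) (solve (j ∷ [])) (second-early b) refl
  recurrence-second b@(even zero _) (suc q) =
    from-three (second b) (suc q) (first two) (suc q) (first (odd 0 z<s)) (suc q) (second (odd 0 z<s)) q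
      (solve (j ∷ q ∷ [])) (solve (j ∷ q ∷ [])) (solve (j ∷ q ∷ [])) refl
  recurrence-second b@(even (suc i) h) zero =
    from-two (second b) (second (odd i (shorter h))) (first (odd (suc i) h))
      (solve (j ∷ i ∷ [])) (solve (j ∷ i ∷ [])) (second-early b) refl
  recurrence-second b@(even (suc i) h) (suc q) =
    from-three (second b) (suc q) (second (odd i (shorter h))) (suc q) (first (odd (suc i) h)) (suc q)
      (second (odd (suc i) h)) q
      (solve (j ∷ i ∷ q ∷ [])) (solve (j ∷ i ∷ q ∷ [])) (solve (j ∷ i ∷ q ∷ [])) refl
  recurrence-second b@(odd i h) zero with m<1+n⇒m<n∨m≡n h
  ... | inj₁ i<1+j =
    from-two (second b) (second (even i h)) (first (even (suc i) (s≤s i<1+j)))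
      (solve (j ∷ i ∷ [])) (solve (j ∷ i ∷ [])) (second-early b) refl
  ... | inj₂ refl =
    from-two (second b) (second (even (1 + j) h)) (first two) (solve (j ∷ [])) (solve (j ∷ [])) (second-early b) refl
  recurrence-second b@(odd i h) (suc q) with m<1+n⇒m<n∨m≡n h
  ... | inj₁ i<1+j =
    from-three (second b) (suc q) (second (even i h)) (suc q) (first (even (suc i) (s≤s i<1+j))) (suc q)
      (second (even (suc i) (s≤s i<1+j))) q
      (solve (j ∷ i ∷ q ∷ [])) (solve (j ∷ i ∷ q ∷ [])) (solve (j ∷ i ∷ q ∷ [])) refl
  ... | inj₂ refl =
    from-three (second b) (suc q) (second (even (1 + j) h)) (suc q) (first two) (suc q) (second two) q
      (solve (j ∷ q ∷ [])) (solve (j ∷ q ∷ [])) (solve (j ∷ q ∷ [])) refl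
  recurrence-second two zero =
    from-two (second two) (second (odd (1 + j) ≤-refl)) (second (even 0 z<s))
      (solve (j ∷ [])) (solve (j ∷ [])) (second-early two) refl
  recurrence-second two (suc q) =
    from-three (second two) (suc q) (second (odd (1 + j) ≤-refl)) (suc q) (second (even 0 z<s)) (suc q)
      (third (even 0 z<s)) q
      (solve (j ∷ q ∷ [])) (solve (j ∷ q ∷ [])) (solve (j ∷ q ∷ [])) refl

  recurrence-third : ∀ {x} (b : Block (1 + j) x) q → Recurrence (third b) q
  recurrence-third b@(even zero h) zero =
    from-two (third b) (second two) (second (odd 0 z<s))
      (solve (j ∷ [])) (solve (j ∷ [])) (third-early (even-< h)) refl
  recurrence-third b@(even zero _) (suc q) =
    from-three (third b) (suc q) (second two) (suc q) (second (odd 0 z<s)) (suc q) (third (odd 0 z<s)) q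
      (solve (j ∷ q ∷ [])) (solve (j ∷ q ∷ [])) (solve (j ∷ q ∷ [])) refl
  recurrence-third b@(even (suc i) h) zero =
    from-two (third b) (third (odd i (shorter h))) (second (odd (suc i) (m<n⇒m<1+n h)))
      (solve (j ∷ i ∷ [])) (solve (j ∷ i ∷ [])) (third-early (even-< h)) refl
  recurrence-third b@(even (suc i) h) (suc q) =
    from-three (third b) (suc q) (third (odd i (shorter h))) (suc q) (second (odd (suc i) (m<n⇒m<1+n h))) (suc q)
      (third (odd (suc i) h)) q
      (solve (j ∷ i ∷ q ∷ [])) (solve (j ∷ i ∷ q ∷ [])) (solve (j ∷ i ∷ q ∷ [])) refl
  recurrence-third b@(odd i h) zero =
    from-two (third b) (third (even i h)) (second (even (suc i) (s≤s h)))
      (solve (j ∷ i ∷ [])) (solve (j ∷ i ∷ [])) (third-early (odd-< h)) refl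
  recurrence-third b@(odd i h) (suc q) with m<1+n⇒m<n∨m≡n h
  ... | inj₁ i<j =
    from-three (third b) (suc q) (third (even i h)) (suc q) (second (even (suc i) (s≤s h))) (suc q)
      (third (even (suc i) (s≤s i<j))) q
      (solve (j ∷ i ∷ q ∷ [])) (solve (j ∷ i ∷ q ∷ [])) (solve (j ∷ i ∷ q ∷ [])) refl
  ... | inj₂ refl =
    from-three (third b) (suc q) (third (even j h)) (suc q) (second (even (suc j) (s≤s h))) (suc q) (third two) q
      (solve (j ∷ q ∷ [])) (solve (j ∷ q ∷ [])) (solve (j ∷ q ∷ [])) refl
  recurrence-third two q =
    from-three (third two) q (third (odd j ≤-refl)) q (second (odd (1 + j) ≤-refl)) q (first (even 0 z<s)) q
      (solve (j ∷ q ∷ [])) (solve (j ∷ q ∷ [])) (solve (j ∷ q ∷ [])) refl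

  ν-solves : SolvesMex S ν
  ν-solves n with residue-of n
  ... | r , q , c , refl = trans (ν-at c q refl) (recurrence c)
    where
    recurrence : ∀ {r} (c : Residue r) → Recurrence c q
    recurrence (first b) = recurrence-first b q
    recurrence (second b) = recurrence-second b q
    recurrence (third b) = recurrence-third b q

  G≡ν : ∀ n → nimValue S n ≡ ν n
  G≡ν = nimValue-unique S ν ν-solves

  G-periodic : Periodic S p
  G-periodic n = begin
    nimValue S (n + p) ≡⟨ G≡ν (n + p) ⟩
    ν (n + p)          ≡⟨ cong (λ i → fromMaybe 0 (at word i)) ([m+n]%n≡m%n n p) ⟩
    ν n                ≡⟨ sym (G≡ν n) ⟩
    nimValue S n       ∎
    where open ≡-Reasoning

  spoiled-at : ∀ r n {r₁ r₂} (c₁ : Residue r₁) q₁ (c₂ : Residue r₂) q₂ →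
    n + r ≡ r₁ + q₁ * (13 + 6 * j) → n ≡ r₂ + q₂ * (13 + 6 * j) → value c₁ ≢ value c₂ →
    ∃ λ n → ν (n + r) ≢ ν n
  spoiled-at r n c₁ q₁ c₂ q₂ e₁ e₂ ne =
    n , λ eq → ne (trans (sym (ν-at c₁ q₁ e₁)) (trans eq (ν-at c₂ q₂ e₂)))

  -- Position 0 carries the value 0, so a residue of nonzero value is spoiled at 0.
  spoiled-at-0 : ∀ {r} (c : Residue r) → value c ≢ 0 → ∃ λ n → ν (n + r) ≢ ν n
  spoiled-at-0 {r} c ne = spoiled-at r 0 c 0 (first (even 0 z<s)) 0 (sym (+-identityʳ r)) refl ne

  not-a-period : ∀ {r} (c : Residue r) → 1 ≤ r → ∃ λ n → ν (n + r) ≢ ν n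
  not-a-period (first (even zero _)) ()
  not-a-period (first (even (suc i) h)) _ =
    spoiled-at (suc i + suc i) ((2 + j) + (2 + j)) (second (odd i (shorter h))) 0 (first two) 0
      (solve (j ∷ i ∷ [])) (solve (j ∷ [])) (λ ())
  not-a-period c@(first (odd _ _)) _ = spoiled-at-0 c (λ ())
  not-a-period c@(first two)       _ = spoiled-at-0 c (λ ())
  not-a-period (second (even i h)) _ =
    spoiled-at (5 + 2 * j + (i + i)) (5 + 2 * j + ((2 + j) + (2 + j))) (first (odd i h)) 1 (second two) 0
      (solve (j ∷ i ∷ [])) (solve (j ∷ [])) (λ ())
  not-a-period c@(second (odd _ _)) _ = spoiled-at-0 c (λ ())
  not-a-period c@(second two)       _ = spoiled-at-0 c (λ ())
  not-a-period (third (even i h)) _ =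
    spoiled-at (10 + 4 * j + (i + i)) ((2 + j) + (2 + j)) (first (odd i (m<n⇒m<1+n h))) 1 (first two) 0
      (solve (j ∷ i ∷ [])) (solve (j ∷ [])) (λ ())
  not-a-period c@(third (odd _ _)) _ = spoiled-at-0 c (λ ())
  not-a-period c@(third two)       _ = spoiled-at-0 c (λ ())

  G-minimal : ∀ q → 1 ≤ q → q < p → ¬ (∀ n → nimValue S (n + q) ≡ nimValue S n)
  G-minimal q 1≤q q<p periodic with not-a-period (classify q (subst (q <_) p≡ q<p)) 1≤q
  ... | n , differ = differ (trans (sym (G≡ν (n + q))) (trans (periodic n) (G≡ν n)))

  X : List ℕ
  X = 1 ∷ (2 + j) * 2 ∷ 2 * ((2 + j) * 2) + 1 ∷ 3 * ((2 + j) * 2) ∷ []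

  repeated-at : ∀ r n {r₁ r₂} (c₁ : Residue r₁) q₁ (c₂ : Residue r₂) q₂ →
    n + r ≡ r₁ + q₁ * (13 + 6 * j) → n ≡ r₂ + q₂ * (13 + 6 * j) → value c₁ ≡ value c₂ →
    ∃ λ n → ν (n + r) ≡ ν n
  repeated-at r n c₁ q₁ c₂ q₂ e₁ e₂ eq =
    n , trans (ν-at c₁ q₁ e₁) (trans eq (sym (ν-at c₂ q₂ e₂)))

  repeated-at-0 : ∀ {r} (c : Residue r) → value c ≡ 0 → ∃ λ n → ν (n + r) ≡ ν n
  repeated-at-0 {r} c eq = repeated-at r 0 c 0 (first (even 0 z<s)) 0 (sym (+-identityʳ r)) refl eq

  star-or-repeated : ∀ {r} (c : Residue r) → InStar X p r ⊎ ∃ λ n → ν (n + r) ≡ ν n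
  star-or-repeated c@(first (even _ _)) = inj₂ (repeated-at-0 c refl)
  star-or-repeated (first (odd zero _)) = inj₁ (1 , 0 , here , refl)
  star-or-repeated (first (odd (suc i) h)) =
    inj₂ (repeated-at (suc (suc i + suc i)) ((1 + j) + (1 + j))
      (second (even i (shorter h))) 0 (first (even (1 + j) ≤-refl)) 0
      (solve (j ∷ i ∷ [])) (solve (j ∷ [])) refl)
  star-or-repeated (first two) = inj₁ ((2 + j) * 2 , 0 , there here , solve (j ∷ []))
  star-or-repeated c@(second (even _ _)) = inj₂ (repeated-at-0 c refl)
  star-or-repeated (second (odd i h)) =
    inj₂ (repeated-at (5 + 2 * j + suc (i + i)) (5 + 2 * j + suc ((1 + j) + (1 + j)))
      (first (odd i h)) 1 (second (odd (1 + j) ≤-refl)) 0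
      (solve (j ∷ i ∷ [])) (solve (j ∷ [])) refl)
  star-or-repeated (second two) = inj₁ (2 * ((2 + j) * 2) + 1 , 0 , there (there here) , solve (j ∷ []))
  star-or-repeated c@(third (even _ _)) = inj₂ (repeated-at-0 c refl)
  star-or-repeated (third (odd i h)) =
    inj₂ (repeated-at (10 + 4 * j + suc (i + i)) (suc ((1 + j) + (1 + j)))
      (first (odd i (m<n⇒m<1+n h))) 1 (first (odd (1 + j) ≤-refl)) 0
      (solve (j ∷ i ∷ [])) (solve (j ∷ [])) refl)
  star-or-repeated (third two) = inj₁ (3 * ((2 + j) * 2) , 0 , there (there (there here)) , solve (j ∷ []))

  expansion-in-star : ∀ s → InExpansion S s → InStar X p s
  expansion-in-star s (_ , never) with residue-of s
  ... | r , q , c , refl with star-or-repeated c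
  ...   | inj₁ r∈X^p = subst (InStar X p) (cong (λ p′ → r + q * p′) p≡) (star-+-period r∈X^p q)
  ...   | inj₂ (n , same) = ⊥-elim (never n (begin
    nimValue S (n + (r + q * (13 + 6 * j))) ≡⟨ G≡ν (n + (r + q * (13 + 6 * j))) ⟩
    ν (n + (r + q * (13 + 6 * j)))          ≡⟨ cong ν (sym (+-assoc n r (q * (13 + 6 * j)))) ⟩
    ν (n + r + q * (13 + 6 * j))            ≡⟨ ν-+-multiple (n + r) q ⟩
    ν (n + r)                               ≡⟨ same ⟩
    ν n                                     ≡⟨ sym (G≡ν n) ⟩
    nimValue S n                            ∎))
    where open ≡-Reasoning

  half-a : (2 + j) * 2 / 2 ≡ 2 + j
  half-a = m*n/n≡m (2 + j) 2

  claim : NimSequenceAndExpansion ((2 + j) * 2)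
  claim rewrite half-a =
    ( G-periodic , G-minimal , trans (cong length word-shape) (trans word-length (sym p≡))
    , λ n → trans (cong (λ w → at w (n % p)) word-shape) (trans (ν-lookup n) (cong just (sym (G≡ν n)))) )
    , λ s → mk⇔ (expansion-in-star s) (star-in-expansion _ (s≤s z≤n) G-periodic s)

theorem3p12 : (a : ℕ) → 4 ≤ a → 2 ∣ a →
    PeriodicWith (1 ∷ a ∷ 3 * a ∷ []) (1 + 3 * a)
      (rep 2 (rep (a / 2) (0 ∷ 1 ∷ []) ++ (2 ∷ [])) ++ rep (a / 2 ∸ 1) (0 ∷ 1 ∷ []) ++ (2 ∷ []))
    × HasExpansion (1 ∷ a ∷ 3 * a ∷ [])
        (InStar (1 ∷ a ∷ 2 * a + 1 ∷ 3 * a ∷ []) (1 + 3 * a))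
theorem3p12 _ ()                  (divides zero          refl)
theorem3p12 _ (s≤s (s≤s ()))      (divides (suc zero)    refl)
theorem3p12 _ _                   (divides (suc (suc j)) refl) = Game.claim j
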